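{- Given a BI algebra (respectively, BBI algebra) $\mathbb{A}$, the prime filter frame $Pr(\mathbb{A})=(Pr(\mathbb{A}),\subseteq,\circ_{\mathbb{A}},E_{\mathbb{A}})$ is a BI frame (respectively, $(Pr(\mathbb{A}),\circ_{\mathbb{A}},E_{\mathbb{A}})$ is a BBI frame).
   Context: A BI algebra is $\mathbb{A}=(A,\wedge,\vee,\rightarrow,\top,\bot,*,\mathbin{ -\!\!*},\top^*)$ with Heyting algebra reduct, $(A,*,\top^*)$ a commutative monoid, and $a*b\le c$ iff $a\le b\mathbin{ -\!\!*}c$; a BBI algebra has Boolean lattice reduct. $Pr(\mathbb{A})$ is the set of prime filters of $\mathbb{A}$ (proper filters $F$ with $a\vee b\in F\Rightarrow a\in F$ or $b\in F$); $F\circ_{\mathbb{A}}F'=\{F''\in Pr(\mathbb{A})\mid\forall a\in F,b\in F':a*b\in F''\}$; $E_{\mathbb{A}}=\{F\mid\top^*\in F\}$. A BI frame is $(X,\preccurlyeq,\circ,E)$ with $\preccurlyeq$ a preorder, $\circ:X^2\to\mathcal{P}(X)$, $E\subseteq X$ satisfying: (Commutativity) $z\in x\circ y\to z\in y\circ x$; (Closure) $e\in E\wedge e'\succcurlyeq e\to e'\in E$; (Unit Existence) $\exists e\in E(x\in x\circ e)$; (Coherence) $e\in E\wedge x\in y\circ e\to x\succcurlyeq y$; (Associativity) $t'\succcurlyeq t\in x\circ y\wedge w\in t'\circ z\to\exists s,s',w'(s'\succcurlyeq s\in y\circ z\wedge w\succcurlyeq w'\in x\circ s')$. A BBI frame $(X,\circ,E)$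 satisfies Commutativity, Unit Existence, Coherence $x\in y\circ e\wedge e\in E\to y=x$, and Associativity $t\in x\circ y\wedge w\in t\circ z\to\exists s(s\in y\circ z\wedge w\in x\circ s)$. -}

module Defs where

open import Level using (Level; _⊔_; suc)
open import Data.Product using (Σ; ∃; ∃-syntax; _×_; _,_; proj₁)
open import Data.Sum using (_⊎_)
open import Data.Empty using (⊥)
open import Relation.Nullary using (¬_)
open import Relation.Binary.Core using (Rel)
open import Relation.Binary.Lattice.Structures using (IsHeytingAlgebra)
open import Algebra.Structures using (IsCommutativeMonoid)
open import Relation.Unary using (Pred; _∈_; _∉_; _⊆_)

record BIAlgebra (c ℓ₁ ℓ₂ : Level) : Set (suc (c ⊔ ℓ₁ ⊔ ℓ₂)) where
  infixr 6 _∨_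
  infixr 7 _∧_
  infixr 5 _⇒_
  infixr 7 _*_
  infixr 5 _-*_
  infix 4 _≈_ _≤_
  field
    Carrier : Set c
    _≈_     : Rel Carrier ℓ₁
    _≤_     : Rel Carrier ℓ₂
    _∧_ _∨_ _⇒_ : Carrier → Carrier → Carrier
    ⊤ ⊥ₐ    : Carrier
    _*_ _-*_ : Carrier → Carrier → Carrier
    ⊤*      : Carrier
    isHeytingAlgebra : IsHeytingAlgebra _≈_ _≤_ _∨_ _∧_ _⇒_ ⊤ ⊥ₐ
    isCommutativeMonoid : IsCommutativeMonoid _≈_ _*_ ⊤*
    residuation₁ : ∀ a b c → a * b ≤ c → a ≤ b -* c
    residuation₂ : ∀ a b c → a ≤ b -* c → a * b ≤ c

IsBoolean : ∀ {c ℓ₁ ℓ₂} → BIAlgebra c ℓ₁ ℓ₂ → Set (c ⊔ ℓ₁)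
IsBoolean A = ∀ a → ∃[ b ] ((a ∧ b ≈ ⊥ₐ) × (a ∨ b ≈ ⊤))
  where open BIAlgebra A

record BBIAlgebra (c ℓ₁ ℓ₂ : Level) : Set (suc (c ⊔ ℓ₁ ⊔ ℓ₂)) where
  field
    biAlgebra : BIAlgebra c ℓ₁ ℓ₂
    boolean   : IsBoolean biAlgebra
  open BIAlgebra biAlgebra public

module _ {c ℓ₁ ℓ₂} (A : BIAlgebra c ℓ₁ ℓ₂) where
  open BIAlgebra A

  Subset : Set (suc (c ⊔ ℓ₁ ⊔ ℓ₂))
  Subset = Pred Carrier (c ⊔ ℓ₁ ⊔ ℓ₂)

  record IsFilter (F : Subset) : Set (c ⊔ ℓ₁ ⊔ ℓ₂) where
    field
      ⊤∈     : ⊤ ∈ F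
      ∧-closed : ∀ {a b} → a ∈ F → b ∈ F → a ∧ b ∈ F
      up-closed : ∀ {a b} → a ∈ F → a ≤ b → b ∈ F

  record IsIdeal (I : Subset) : Set (c ⊔ ℓ₁ ⊔ ℓ₂) where
    field
      ⊥∈     : ⊥ₐ ∈ I
      ∨-closed : ∀ {a b} → a ∈ I → b ∈ I → a ∨ b ∈ I
      down-closed : ∀ {a b} → a ∈ I → b ≤ a → b ∈ I

  IsProper : Subset → Set (c ⊔ ℓ₁ ⊔ ℓ₂)
  IsProper F = ∃[ a ] (a ∉ F)

  record IsPrimeFilter (F : Subset) : Set (c ⊔ ℓ₁ ⊔ ℓ₂) where
    field
      isFilter : IsFilter F
      proper   : IsProper F
      prime    : ∀ {a b} → a ∨ b ∈ F → (a ∈ F) ⊎ (b ∈ F)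

  Pr : Set (suc (c ⊔ ℓ₁ ⊔ ℓ₂))
  Pr = Σ Subset IsPrimeFilter

  _⊆Pr_ : Rel Pr (c ⊔ ℓ₁ ⊔ ℓ₂)
  F ⊆Pr G = proj₁ F ⊆ proj₁ G

  _≡Pr_ : Rel Pr (c ⊔ ℓ₁ ⊔ ℓ₂)
  F ≡Pr G = (F ⊆Pr G) × (G ⊆Pr F)

  _∘A_∋_ : Pr → Pr → Pr → Set (c ⊔ ℓ₁ ⊔ ℓ₂)
  F ∘A F' ∋ F'' = ∀ {a b} → a ∈ proj₁ F → b ∈ proj₁ F' → a * b ∈ proj₁ F''

  E-A : Pred Pr (c ⊔ ℓ₁ ⊔ ℓ₂)
  E-A F = ⊤* ∈ proj₁ F

  -- Classical principle used in the (ZFC) metatheory of the paper: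
  -- the prime filter theorem for (the lattice reduct of) A.
  PrimeFilterTheorem : Set (suc (c ⊔ ℓ₁ ⊔ ℓ₂))
  PrimeFilterTheorem =
    (F I : Subset) → IsFilter F → IsIdeal I → (∀ {a} → a ∈ F → a ∈ I → ⊥) →
    Σ Pr λ P → (F ⊆ proj₁ P) × (∀ {a} → a ∈ proj₁ P → a ∈ I → ⊥)

ExcludedMiddle : (ℓ : Level) → Set (suc ℓ)
ExcludedMiddle ℓ = (P : Set ℓ) → P ⊎ ¬ P

-- BI frames and BBI frames
-- z ∈ x ∘ y is written  R x y z.

record IsBIFrame {x r : Level} (X : Set x)
                 (_≼_ : Rel X r) (R : X → X → X → Set r) (E : Pred X r)
                 : Set (x ⊔ r) where
  field
    ≼-refl  : ∀ {a} → a ≼ a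
    ≼-trans : ∀ {a b c} → a ≼ b → b ≼ c → a ≼ c
    commutativity : ∀ {x y z} → R x y z → R y x z
    closure : ∀ {e e'} → E e → e ≼ e' → E e'
    unitExistence : ∀ x → ∃[ e ] (E e × R x e x)
    coherence : ∀ {e x y} → E e → R y e x → y ≼ x
    associativity : ∀ {t t' x y z w} → t ≼ t' → R x y t → R t' z w →
      ∃[ s ] ∃[ s' ] ∃[ w' ] (s ≼ s' × R y z s × w' ≼ w × R x s' w')

record IsBBIFrame {x r : Level} (X : Set x)
                  (_≈_ : Rel X r) (R : X → X → X → Set r) (E : Pred X r)
                  : Set (x ⊔ r) where
  field
    commutativity : ∀ {x y z} → R x y z → R y x z
    unitExistence : ∀ x → ∃[ e ] (E e × R x e x)
    coherence : ∀ {e x y} → R y e x → E e → y ≈ x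
    associativity : ∀ {t x y z w} → R x y t → R t z w →
      ∃[ s ] (R y z s × R x s w)

-- The frame axioms that only involve inclusions (preorder, commutativity, closure, coherence)
-- are immediate from the commutative-monoid laws of * and upward closure of filters.  The two
-- existential axioms are proved by one separation argument: given prime filters x, w and a
-- filter F with a * d ∈ w for all a ∈ x, d ∈ F, the ideal {d | ∃ a ∈ x. a * d ∉ w} is disjoint
-- from F, so the prime filter theorem yields a prime s ⊇ F with w ∈ x ∘ s.  Unit existence takes
-- F = ↑ ⊤*, associativity takes F the filter generated by {b * e | b ∈ y, e ∈ z}.  In the
-- Boolean case prime filters are maximal, which upgrades coherence from ⊆ to equality.
module Submission where

open import Defs
open import Level using (_⊔_; Lift; lift)
open import Data.Product using (_×_; Σ; ∃-syntax; _,_; proj₁; proj₂)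
open import Data.Sum using ([_,_]′)
open import Data.Empty using (⊥-elim)
open import Relation.Nullary using (¬_)
open import Relation.Unary using (_∈_; _∉_; _⊆_)
open import Relation.Binary.Lattice.Structures using (module IsHeytingAlgebra)
open import Algebra.Structures using (module IsCommutativeMonoid)

module PrimeFilterFrame {c ℓ₁ ℓ₂} (A : BIAlgebra c ℓ₁ ℓ₂) where
  open BIAlgebra A
  open IsHeytingAlgebra isHeytingAlgebra
    using (reflexive; trans; x≤x∨y; y≤x∨y; ∨-least; x∧y≤x; x∧y≤y; ∧-greatest; maximum; minimum)
    renaming (refl to ≤-refl)
  open IsCommutativeMonoid isCommutativeMonoid using (comm; assoc; identityʳ; sym)

  *-comm-≤ : ∀ a b → a * b ≤ b * a
  *-comm-≤ a b = reflexive (comm a b)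

  *-monoˡ-≤ : ∀ a {b d} → b ≤ d → b * a ≤ d * a
  *-monoˡ-≤ a {b} {d} b≤d = residuation₂ b a _ (trans b≤d (residuation₁ d a _ ≤-refl))

  *-monoʳ-≤ : ∀ a {b d} → b ≤ d → a * b ≤ a * d
  *-monoʳ-≤ a {b} {d} b≤d = trans (*-comm-≤ a b) (trans (*-monoˡ-≤ a b≤d) (*-comm-≤ d a))

  *-distribʳ-∨-≤ : ∀ a b d → (b ∨ d) * a ≤ (b * a) ∨ (d * a)
  *-distribʳ-∨-≤ a b d = residuation₂ (b ∨ d) a _
    (∨-least (residuation₁ b a _ (x≤x∨y _ _)) (residuation₁ d a _ (y≤x∨y _ _)))

  *-distribˡ-∨-≤ : ∀ a b d → a * (b ∨ d) ≤ (a * b) ∨ (a * d)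
  *-distribˡ-∨-≤ a b d = trans (*-comm-≤ a (b ∨ d)) (trans (*-distribʳ-∨-≤ a b d)
    (∨-least (trans (*-comm-≤ b a) (x≤x∨y _ _)) (trans (*-comm-≤ d a) (y≤x∨y _ _))))

  *-zeroʳ-≤ : ∀ a → a * ⊥ₐ ≤ ⊥ₐ
  *-zeroʳ-≤ a = trans (*-comm-≤ a ⊥ₐ) (residuation₂ ⊥ₐ a ⊥ₐ (minimum _))

  *-identityʳ-≤ : ∀ a → a * ⊤* ≤ a
  *-identityʳ-≤ a = reflexive (identityʳ a)

  *-identityʳ-≥ : ∀ a → a ≤ a * ⊤*
  *-identityʳ-≥ a = reflexive (sym (identityʳ a))

  infix 4 _⊆ₚ_ _∘_∋_

  _⊆ₚ_ : Pr A → Pr A → Set (c ⊔ ℓ₁ ⊔ ℓ₂)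
  _⊆ₚ_ = _⊆Pr_ A

  _∘_∋_ : Pr A → Pr A → Pr A → Set (c ⊔ ℓ₁ ⊔ ℓ₂)
  _∘_∋_ = _∘A_∋_ A

  module _ (F : Pr A) where
    open IsPrimeFilter (proj₂ F) public
    open IsFilter isFilter public

  ⊥∉ : (F : Pr A) → ⊥ₐ ∉ proj₁ F
  ⊥∉ F ⊥∈F = let a , a∉F = proper F in a∉F (up-closed F ⊥∈F (minimum a))

  ↑ : Carrier → Subset A
  ↑ a b = Lift (c ⊔ ℓ₁ ⊔ ℓ₂) (a ≤ b)

  ↑-isFilter : ∀ a → IsFilter A (↑ a)
  ↑-isFilter a = record
    { ⊤∈ = lift (maximum a)
    ; ∧-closed = λ { (lift a≤b) (lift a≤d) → lift (∧-greatest a≤b a≤d) }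
    ; up-closed = λ { (lift a≤b) b≤d → lift (trans a≤b b≤d) }
    }

  _⊛_ : Pr A → Pr A → Subset A
  (y ⊛ z) d = ∃[ b ] ∃[ e ] (b ∈ proj₁ y × e ∈ proj₁ z × b * e ≤ d)

  ⊛-isFilter : (y z : Pr A) → IsFilter A (y ⊛ z)
  ⊛-isFilter y z = record
    { ⊤∈ = ⊤ , ⊤ , ⊤∈ y , ⊤∈ z , maximum _
    ; ∧-closed = λ { (b , e , b∈y , e∈z , be≤d) (b' , e' , b'∈y , e'∈z , b'e'≤d') →
        b ∧ b' , e ∧ e' , ∧-closed y b∈y b'∈y , ∧-closed z e∈z e'∈z ,
        ∧-greatest
          (trans (*-monoˡ-≤ _ (x∧y≤x b b')) (trans (*-monoʳ-≤ b (x∧y≤x e e')) be≤d))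
          (trans (*-monoˡ-≤ _ (x∧y≤y b b')) (trans (*-monoʳ-≤ b' (x∧y≤y e e')) b'e'≤d')) }
    ; up-closed = λ { (b , e , b∈y , e∈z , be≤d) d≤d' → b , e , b∈y , e∈z , trans be≤d d≤d' }
    }

  escapes : Pr A → Pr A → Subset A
  escapes x w d = ∃[ a ] (a ∈ proj₁ x × a * d ∉ proj₁ w)

  escapes-isIdeal : (x w : Pr A) → IsIdeal A (escapes x w)
  escapes-isIdeal x w = record
    { ⊥∈ = ⊤ , ⊤∈ x , λ ⊤⊥∈w → ⊥∉ w (up-closed w ⊤⊥∈w (*-zeroʳ-≤ ⊤))
    ; ∨-closed = λ { (a , a∈x , ad∉w) (a' , a'∈x , ad'∉w) →
        a ∧ a' , ∧-closed x a∈x a'∈x , λ aa'[d∨d']∈w →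
          [ (λ ∈w → ad∉w (up-closed w ∈w (*-monoˡ-≤ _ (x∧y≤x a a'))))
          , (λ ∈w → ad'∉w (up-closed w ∈w (*-monoˡ-≤ _ (x∧y≤y a a')))) ]′
          (prime w (up-closed w aa'[d∨d']∈w (*-distribˡ-∨-≤ _ _ _))) }
    ; down-closed = λ { (a , a∈x , ad∉w) d'≤d →
        a , a∈x , λ ad'∈w → ad∉w (up-closed w ad'∈w (*-monoʳ-≤ a d'≤d)) }
    }

  ∘-comm : ∀ {x y z} → x ∘ y ∋ z → y ∘ x ∋ z
  ∘-comm {z = z} x∘y∋z b∈y a∈x = up-closed z (x∘y∋z a∈x b∈y) (*-comm-≤ _ _)

  E-⊆-closed : ∀ {e e'} → E-A A e → e ⊆ₚ e' → E-A A e'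
  E-⊆-closed ⊤*∈e e⊆e' = e⊆e' ⊤*∈e

  ∘-unit-⊆ : ∀ {e x y} → E-A A e → y ∘ e ∋ x → y ⊆ₚ x
  ∘-unit-⊆ {x = x} ⊤*∈e y∘e∋x a∈y = up-closed x (y∘e∋x a∈y ⊤*∈e) (*-identityʳ-≤ _)

  module Classical (lem : ExcludedMiddle (c ⊔ ℓ₁ ⊔ ℓ₂)) (pft : PrimeFilterTheorem A) where

    ¬¬-elim : {P : Set (c ⊔ ℓ₁ ⊔ ℓ₂)} → ¬ ¬ P → P
    ¬¬-elim {P} ¬¬p = [ (λ p → p) , (λ ¬p → ⊥-elim (¬¬p ¬p)) ]′ (lem P)

    ∘-extend : (x w : Pr A) (F : Subset A) → IsFilter A F →
               (∀ {a d} → a ∈ proj₁ x → d ∈ F → a * d ∈ proj₁ w) →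
               Σ (Pr A) λ s → F ⊆ proj₁ s × x ∘ s ∋ w
    ∘-extend x w F F-isFilter x∘F⊆w
      with pft F (escapes x w) F-isFilter (escapes-isIdeal x w)
               (λ d∈F (_ , a∈x , ad∉w) → ad∉w (x∘F⊆w a∈x d∈F))
    ... | s , F⊆s , s∩escapes≡∅ =
      s , F⊆s , λ a∈x d∈s → ¬¬-elim λ ad∉w → s∩escapes≡∅ d∈s (_ , a∈x , ad∉w)

    ∘-unit-exists : ∀ x → ∃[ e ] (E-A A e × x ∘ e ∋ x)
    ∘-unit-exists x =
      let e , ↑⊤*⊆e , x∘e∋x = ∘-extend x x (↑ ⊤*) (↑-isFilter ⊤*) x∘↑⊤*⊆x
      in e , ↑⊤*⊆e (lift ≤-refl) , x∘e∋x
      where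
      x∘↑⊤*⊆x : ∀ {a d} → a ∈ proj₁ x → d ∈ ↑ ⊤* → a * d ∈ proj₁ x
      x∘↑⊤*⊆x {a} a∈x (lift ⊤*≤d) = up-closed x a∈x (trans (*-identityʳ-≥ a) (*-monoʳ-≤ a ⊤*≤d))

    ∘-assoc : ∀ {t t' x y z w} → t ⊆ₚ t' → x ∘ y ∋ t → t' ∘ z ∋ w →
              ∃[ s ] (y ∘ z ∋ s × x ∘ s ∋ w)
    ∘-assoc {t} {t'} {x} {y} {z} {w} t⊆t' x∘y∋t t'∘z∋w =
      let s , y⊛z⊆s , x∘s∋w = ∘-extend x w (y ⊛ z) (⊛-isFilter y z) x∘[y⊛z]⊆w
      in s , (λ b∈y e∈z → y⊛z⊆s (_ , _ , b∈y , e∈z , ≤-refl)) , x∘s∋w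
      where
      x∘[y⊛z]⊆w : ∀ {a d} → a ∈ proj₁ x → d ∈ y ⊛ z → a * d ∈ proj₁ w
      x∘[y⊛z]⊆w {a} a∈x (b , e , b∈y , e∈z , be≤d) =
        up-closed w (t'∘z∋w (t⊆t' (x∘y∋t a∈x b∈y)) e∈z)
          (trans (reflexive (assoc a b e)) (*-monoʳ-≤ a be≤d))

    isBIFrame : IsBIFrame (Pr A) (_⊆Pr_ A) (_∘A_∋_ A) (E-A A)
    isBIFrame = record
      { ≼-refl = λ a∈F → a∈F
      ; ≼-trans = λ F⊆G G⊆H a∈F → G⊆H (F⊆G a∈F)
      ; commutativity = λ {x} {y} {z} → ∘-comm {x} {y} {z}
      ; closure = λ {e} {e'} → E-⊆-closed {e} {e'}
      ; unitExistence = ∘-unit-exists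
      ; coherence = λ {e} {x} {y} → ∘-unit-⊆ {e} {x} {y}
      ; associativity = λ {t} {t'} {x} {y} {z} {w} t⊆t' x∘y∋t t'∘z∋w →
          let s , y∘z∋s , x∘s∋w = ∘-assoc {t} {t'} {x} {y} {z} {w} t⊆t' x∘y∋t t'∘z∋w
          in s , s , w , (λ p → p) , y∘z∋s , (λ p → p) , x∘s∋w
      }

module BooleanPrimeFilterFrame {c ℓ₁ ℓ₂} (A : BBIAlgebra c ℓ₁ ℓ₂) where
  open BBIAlgebra A using (biAlgebra; boolean)
  open BIAlgebra biAlgebra using (isHeytingAlgebra)
  open IsHeytingAlgebra isHeytingAlgebra using (reflexive) renaming (module Eq to ≈)
  open PrimeFilterFrame biAlgebra

  prime-⊆-maximal : ∀ {x y} → y ⊆ₚ x → x ⊆ₚ y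
  prime-⊆-maximal {x} {y} y⊆x {a} a∈x =
    let ¬a , a∧¬a≈⊥ , a∨¬a≈⊤ = boolean a
    in [ (λ a∈y → a∈y)
       , (λ ¬a∈y → ⊥-elim (⊥∉ x (up-closed x (∧-closed x a∈x (y⊆x ¬a∈y)) (reflexive a∧¬a≈⊥))))
       ]′ (prime y (up-closed y (⊤∈ y) (reflexive (≈.sym a∨¬a≈⊤))))

  isBBIFrame : ExcludedMiddle (c ⊔ ℓ₁ ⊔ ℓ₂) → PrimeFilterTheorem biAlgebra →
               IsBBIFrame (Pr biAlgebra) (_≡Pr_ biAlgebra) (_∘A_∋_ biAlgebra) (E-A biAlgebra)
  isBBIFrame lem pft = record
    { commutativity = λ {x} {y} {z} → ∘-comm {x} {y} {z}
    ; unitExistence = ∘-unit-exists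
    ; coherence = λ {e} {x} {y} y∘e∋x ⊤*∈e →
        let y⊆x = ∘-unit-⊆ {e} {x} {y} ⊤*∈e y∘e∋x in y⊆x , prime-⊆-maximal {x} {y} y⊆x
    ; associativity = λ {t} {x} {y} {z} {w} → ∘-assoc {t} {t} {x} {y} {z} {w} (λ p → p)
    }
    where open Classical lem pft

lemma4p12 : ∀ {c ℓ₁ ℓ₂}
    → ((A : BIAlgebra c ℓ₁ ℓ₂) → ExcludedMiddle (c ⊔ ℓ₁ ⊔ ℓ₂) → PrimeFilterTheorem A
        → IsBIFrame (Pr A) (_⊆Pr_ A) (_∘A_∋_ A) (E-A A))
    × ((A : BBIAlgebra c ℓ₁ ℓ₂) → ExcludedMiddle (c ⊔ ℓ₁ ⊔ ℓ₂) → PrimeFilterTheorem (BBIAlgebra.biAlgebra A)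
        → IsBBIFrame (Pr (BBIAlgebra.biAlgebra A)) (_≡Pr_ (BBIAlgebra.biAlgebra A)) (_∘A_∋_ (BBIAlgebra.biAlgebra A)) (E-A (BBIAlgebra.biAlgebra A)))
lemma4p12 = PrimeFilterFrame.Classical.isBIFrame , BooleanPrimeFilterFrame.isBBIFrame
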